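{- For all integers $k,n\geq 1$, $$J^k_n=J^{k-1}_n+\sum_{s=0}^{n-1}\binom{n}{s}J^{k-1}_s\,J^0_{n-s}.$$
   Context: Let $X_n=\{1,\dots,n\}$. A preferential arrangement of $X_n$ is an ordered set partition: a linearly ordered sequence of pairwise disjoint nonempty subsets (blocks) whose union is $X_n$. A barred preferential arrangement of $X_n$ with $m$ bars is a preferential arrangement of $X_n$ together with $m$ indistinguishable bars inserted into the sequence of blocks (before the first block, between blocks, or after the last block, several bars possibly in the same place). Equivalently, it is a sequence of $m+1$ sections $S_1,\dots,S_{m+1}$, where the $S_i$ are pairwise disjoint, possibly empty, subsets with union $X_n$, and each $S_i$ carries a preferential arrangement of its elements. $J^m_n$ denotes the number of barred preferential arrangements of $X_n$ with $m$ bars; $J^0_n$ is the number of preferential arrangements of $X_n$, and $J^m_0=1$. -}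

module Defs where

open import Data.Nat using (ℕ; zero; suc; _+_; _*_; _∸_; _≟_)
open import Data.Bool using (Bool; true; false; if_then_else_)
open import Data.Maybe using (Maybe; just; nothing)
open import Data.Vec using (Vec; []; _∷_; lookup)
open import Data.Fin using (Fin)
open import Data.List using (List; []; _∷_; length; filter; concatMap; map; applyUpTo)
open import Data.List.Relation.Unary.All using (All)
open import Data.Nat.Combinatorics using (_C_)
open import Relation.Binary.PropositionalEquality using (_≡_)
open import Relation.Nullary using (Dec; yes; no; ¬_)
open import Relation.Nullary.Decidable using (_×-dec_; ¬?)
open import Relation.Unary using (Decidable)
open import Data.Product using (_×_)

-- A subset of X_n = {1,…,n}, represented by its characteristic vector
-- (index i : Fin n stands for element i+1).
Subset : ℕ → Set
Subset n = Vec Bool n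

allSubsets : (n : ℕ) → List (Subset n)
allSubsets zero = [] ∷ []
allSubsets (suc n) = concatMap (λ s → (false ∷ s) ∷ (true ∷ s) ∷ []) (allSubsets n)

-- A token of a barred preferential arrangement: either a bar (nothing)
-- or a block (just S).
Token : ℕ → Set
Token n = Maybe (Subset n)

wordsOfLength : (n L : ℕ) → List (List (Token n))
wordsOfLength n zero = [] ∷ []
wordsOfLength n (suc L) =
  concatMap (λ w → map (λ t → t ∷ w) (nothing ∷ map just (allSubsets n)))
            (wordsOfLength n L)

wordsUpTo : (n L : ℕ) → List (List (Token n))
wordsUpTo n zero = wordsOfLength n zero
wordsUpTo n (suc L) = wordsOfLength n (suc L) Data.List.++ wordsUpTo n L

bars : ∀ {n} → List (Token n) → ℕ
bars [] = 0
bars (nothing ∷ w) = suc (bars w)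
bars (just _ ∷ w) = bars w

occurrences : ∀ {n} → Fin n → List (Token n) → ℕ
occurrences i [] = 0
occurrences i (nothing ∷ w) = occurrences i w
occurrences i (just S ∷ w) = (if lookup S i then 1 else 0) + occurrences i w

data NonEmptySubset : ∀ {n} → Subset n → Set where
  here  : ∀ {n} {s : Subset n} → NonEmptySubset (true ∷ s)
  there : ∀ {n} {b} {s : Subset n} → NonEmptySubset s → NonEmptySubset (b ∷ s)

nonEmpty? : ∀ {n} (s : Subset n) → Dec (NonEmptySubset s)
nonEmpty? [] = no (λ ())
nonEmpty? (true ∷ s) = yes here
nonEmpty? (false ∷ s) with nonEmpty? s
... | yes p = yes (there p)
... | no ¬p = no λ { (there p) → ¬p p }

data BlocksNonEmpty {n : ℕ} : List (Token n) → Set where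
  []    : BlocksNonEmpty []
  bar∷  : ∀ {w} → BlocksNonEmpty w → BlocksNonEmpty (nothing ∷ w)
  blk∷  : ∀ {S w} → NonEmptySubset S → BlocksNonEmpty w → BlocksNonEmpty (just S ∷ w)

blocksNonEmpty? : ∀ {n} (w : List (Token n)) → Dec (BlocksNonEmpty w)
blocksNonEmpty? [] = yes []
blocksNonEmpty? (nothing ∷ w) with blocksNonEmpty? w
... | yes p = yes (bar∷ p)
... | no ¬p = no λ { (bar∷ p) → ¬p p }
blocksNonEmpty? (just S ∷ w) with nonEmpty? S | blocksNonEmpty? w
... | yes p | yes q = yes (blk∷ p q)
... | no ¬p | _ = no λ { (blk∷ p q) → ¬p p }
... | yes _ | no ¬q = no λ { (blk∷ p q) → ¬q q }

-- every element of X_n lies in exactly one block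
-- (blocks pairwise disjoint with union X_n)
Covers : ∀ {n} → List (Token n) → Set
Covers {n} w = (i : Fin n) → occurrences i w ≡ 1

covers? : ∀ {n} (w : List (Token n)) → Dec (Covers w)
covers? {n} w = Data.Fin.Properties.all? (λ i → occurrences i w ≟ 1)
  where import Data.Fin.Properties

-- A barred preferential arrangement of X_n with m bars, encoded as the
-- left-to-right sequence of its blocks and bars.
IsBPA : (n m : ℕ) → List (Token n) → Set
IsBPA n m w = (bars w ≡ m) × BlocksNonEmpty w × Covers w

isBPA? : (n m : ℕ) → Decidable (IsBPA n m)
isBPA? n m w = (bars w ≟ m) ×-dec (blocksNonEmpty? w ×-dec covers? w)

-- Such a word has m bars and at most n blocks (blocks are nonempty and
-- disjoint), so its length is at most n + m: the enumeration below is complete.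
J : ℕ → ℕ → ℕ
J m n = length (filter (isBPA? n m) (wordsUpTo n (n + m)))

sumBelow : ℕ → (ℕ → ℕ) → ℕ
sumBelow zero f = 0
sumBelow (suc n) f = sumBelow n f + f n

-- Read a barred preferential arrangement token by token and count, more generally, the
-- arrangements of an arbitrary subset U of X_n. Removing the first token gives a recursion:
-- either a bar (one bar fewer), or a nonempty block S ⊆ U followed by an arrangement of U ∖ S.
-- From this recursion, by induction on |U|, the count depends on |U| only, and the count with
-- k+1 bars is the convolution Σ_{T ⊔ R = U} (arrangements of T with 0 bars) · (arrangements of
-- R with k bars): T is the section before the first bar. The induction step for the latter is
-- the associativity of ordered splittings U = S ⊔ T ⊔ R. Grouping the splittings of X_n by
-- sizes yields the binomial coefficients, and the term s = n is J^k_n because J^0_0 = 1.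
module Submission where

open import Defs
open import Data.Nat using (ℕ; zero; suc; _+_; _*_; _∸_; _≤_; _<_; _≤′_; ≤′-refl; ≤′-step; _≡ᵇ_; s≤s; s≤s⁻¹)
open import Data.Nat.Properties
open import Data.Nat.Combinatorics using (_C_; nCn≡1; nCk+nC[k+1]≡[n+1]C[k+1]; k>n⇒nCk≡0)
open import Algebra.Properties.CommutativeSemigroup +-commutativeSemigroup using (interchange)
open import Data.Bool using (Bool; true; false; T; not; _∧_; if_then_else_)
open import Data.Bool.Properties using (T-∧)
open import Data.Empty using (⊥-elim)
open import Data.Maybe using (just; nothing)
open import Data.Vec using ([]; _∷_; lookup)
open import Data.Vec.Properties using (lookup-replicate)
open import Data.Fin using (Fin; zero; suc)
open import Data.Fin.Subset using (⊤; ∣_∣; _─_)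
open import Data.Fin.Subset.Properties using (∣⊤∣≡n; ∣p∣≤n)
open import Data.List using (List; []; _∷_; length; filter; concatMap; map; _++_)
open import Data.Product using (_×_; _,_; proj₁; proj₂)
open import Function.Bundles using (_⇔_; mk⇔; module Equivalence)
open import Relation.Binary.PropositionalEquality hiding (J)
open import Relation.Nullary using (Dec; yes; no; does)
open Equivalence using (to; from)
open ≡-Reasoning

-- Sums

𝟙 : Bool → ℕ
𝟙 b = if b then 1 else 0

𝟙-∧ : ∀ a b → 𝟙 (a ∧ b) ≡ 𝟙 a * 𝟙 b
𝟙-∧ false b = refl
𝟙-∧ true  b = sym (+-identityʳ (𝟙 b))

does-≡ : ∀ {P : Set} (P? : Dec P) {b : Bool} → P ⇔ T b → does P? ≡ b
does-≡ (yes p)  {false} P⇔b = ⊥-elim (to P⇔b p)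
does-≡ (yes _)  {true}  _   = refl
does-≡ (no _)   {false} _   = refl
does-≡ (no ¬p)  {true}  P⇔b = ⊥-elim (¬p (from P⇔b _))

∑ : ∀ {A : Set} → List A → (A → ℕ) → ℕ
∑ []       f = 0
∑ (x ∷ xs) f = f x + ∑ xs f

∑-cong : ∀ {A : Set} (xs : List A) {f g : A → ℕ} → (∀ x → f x ≡ g x) → ∑ xs f ≡ ∑ xs g
∑-cong []       f≡g = refl
∑-cong (x ∷ xs) f≡g = cong₂ _+_ (f≡g x) (∑-cong xs f≡g)

∑-zero : ∀ {A : Set} (xs : List A) → ∑ xs (λ _ → 0) ≡ 0
∑-zero []       = refl
∑-zero (_ ∷ xs) = ∑-zero xs

∑-++ : ∀ {A : Set} (xs ys : List A) (f : A → ℕ) → ∑ (xs ++ ys) f ≡ ∑ xs f + ∑ ys f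
∑-++ []       ys f = refl
∑-++ (x ∷ xs) ys f = trans (cong (f x +_) (∑-++ xs ys f)) (sym (+-assoc (f x) _ _))

∑-concatMap : ∀ {A B : Set} (g : A → List B) xs (f : B → ℕ) → ∑ (concatMap g xs) f ≡ ∑ xs (λ x → ∑ (g x) f)
∑-concatMap g []       f = refl
∑-concatMap g (x ∷ xs) f = trans (∑-++ (g x) _ f) (cong (∑ (g x) f +_) (∑-concatMap g xs f))

∑-map : ∀ {A B : Set} (h : A → B) xs (f : B → ℕ) → ∑ (map h xs) f ≡ ∑ xs (λ x → f (h x))
∑-map h []       f = refl
∑-map h (x ∷ xs) f = cong (f (h x) +_) (∑-map h xs f)

∑-+ : ∀ {A : Set} (xs : List A) (f g : A → ℕ) → ∑ xs (λ x → f x + g x) ≡ ∑ xs f + ∑ xs g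
∑-+ []       f g = refl
∑-+ (x ∷ xs) f g = trans (cong (f x + g x +_) (∑-+ xs f g)) (interchange (f x) (g x) _ _)

∑-* : ∀ {A : Set} (xs : List A) a (f : A → ℕ) → ∑ xs (λ x → a * f x) ≡ a * ∑ xs f
∑-* []       a f = sym (*-zeroʳ a)
∑-* (x ∷ xs) a f = trans (cong (a * f x +_) (∑-* xs a f)) (sym (*-distribˡ-+ a (f x) _))

∑-comm : ∀ {A B : Set} (xs : List A) (ys : List B) (f : A → B → ℕ) →
  ∑ xs (λ x → ∑ ys (f x)) ≡ ∑ ys (λ y → ∑ xs (λ x → f x y))
∑-comm []       ys f = sym (∑-zero ys)
∑-comm (x ∷ xs) ys f = trans (cong (∑ ys (f x) +_) (∑-comm xs ys f)) (sym (∑-+ ys (f x) _))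

length-filter≡∑ : ∀ {A : Set} {P : A → Set} (P? : ∀ x → Dec (P x)) xs →
  length (filter P? xs) ≡ ∑ xs (λ x → 𝟙 (does (P? x)))
length-filter≡∑ P? [] = refl
length-filter≡∑ P? (x ∷ xs) with does (P? x)
... | true  = cong suc (length-filter≡∑ P? xs)
... | false = length-filter≡∑ P? xs

sumBelow-cong : ∀ n {f g : ℕ → ℕ} → (∀ s → s < n → f s ≡ g s) → sumBelow n f ≡ sumBelow n g
sumBelow-cong zero    f≡g = refl
sumBelow-cong (suc n) f≡g = cong₂ _+_ (sumBelow-cong n (λ s s<n → f≡g s (m<n⇒m<1+n s<n))) (f≡g n ≤-refl)

sumBelow-zero : ∀ n → sumBelow n (λ _ → 0) ≡ 0
sumBelow-zero zero    = refl
sumBelow-zero (suc n) = trans (+-identityʳ _) (sumBelow-zero n)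

sumBelow-+ : ∀ n (f g : ℕ → ℕ) → sumBelow n (λ s → f s + g s) ≡ sumBelow n f + sumBelow n g
sumBelow-+ zero    f g = refl
sumBelow-+ (suc n) f g = trans (cong (_+ (f n + g n)) (sumBelow-+ n f g)) (interchange (sumBelow n f) _ _ _)

sumBelow-* : ∀ n a (f : ℕ → ℕ) → sumBelow n (λ s → a * f s) ≡ a * sumBelow n f
sumBelow-* zero    a f = sym (*-zeroʳ a)
sumBelow-* (suc n) a f = trans (cong (_+ a * f n) (sumBelow-* n a f)) (sym (*-distribˡ-+ a _ (f n)))

sumBelow-suc : ∀ n (f : ℕ → ℕ) → sumBelow (suc n) f ≡ f 0 + sumBelow n (λ s → f (suc s))
sumBelow-suc zero    f = +-comm 0 (f 0)
sumBelow-suc (suc n) f = trans (cong (_+ f (suc n)) (sumBelow-suc n f)) (+-assoc (f 0) _ _)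

sumBelow-vanishing : ∀ {K B} (f : ℕ → ℕ) → (∀ L → K ≤ L → f L ≡ 0) → K ≤ B → sumBelow B f ≡ sumBelow K f
sumBelow-vanishing {K} f vanish K≤B = go (≤⇒≤′ K≤B)
  where
    go : ∀ {B} → K ≤′ B → sumBelow B f ≡ sumBelow K f
    go ≤′-refl = refl
    go (≤′-step {B} K≤′B) =
      trans (cong (sumBelow B f +_) (vanish B (≤′⇒≤ K≤′B))) (trans (+-identityʳ _) (go K≤′B))

sumBelow-pascal : ∀ n (g : ℕ → ℕ) →
  sumBelow (suc (suc n)) (λ s → (suc n C s) * g s) ≡
  sumBelow (suc n) (λ s → (n C s) * g s) + sumBelow (suc n) (λ s → (n C s) * g (suc s))
sumBelow-pascal n g = begin
  sumBelow (suc (suc n)) (λ s → (suc n C s) * g s)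
    ≡⟨ sumBelow-suc (suc n) _ ⟩
  g₀ + sumBelow (suc n) (λ s → (suc n C suc s) * g (suc s))
    ≡⟨ cong (g₀ +_) (sumBelow-cong (suc n) (λ s _ → pascal s)) ⟩
  g₀ + sumBelow (suc n) (λ s → (n C s) * g (suc s) + (n C suc s) * g (suc s))
    ≡⟨ cong (g₀ +_) (sumBelow-+ (suc n) _ _) ⟩
  g₀ + (E + (D + (n C suc n) * g (suc n)))
    ≡⟨ cong (λ c → g₀ + (E + (D + c * g (suc n)))) (k>n⇒nCk≡0 (n<1+n n)) ⟩
  g₀ + (E + (D + 0))
    ≡⟨ cong (λ x → g₀ + (E + x)) (+-identityʳ D) ⟩
  g₀ + (E + D)
    ≡⟨ trans (cong (g₀ +_) (+-comm E D)) (sym (+-assoc g₀ D E)) ⟩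
  g₀ + D + E
    ≡⟨ cong (_+ E) (sym (sumBelow-suc n (λ s → (n C s) * g s))) ⟩
  sumBelow (suc n) (λ s → (n C s) * g s) + E ∎
  where
    g₀ = (n C 0) * g 0
    D  = sumBelow n (λ s → (n C suc s) * g (suc s))
    E  = sumBelow (suc n) (λ s → (n C s) * g (suc s))
    pascal : ∀ s → (suc n C suc s) * g (suc s) ≡ (n C s) * g (suc s) + (n C suc s) * g (suc s)
    pascal s = trans (cong (_* g (suc s)) (sym (nCk+nC[k+1]≡[n+1]C[k+1] n s)))
                     (*-distribʳ-+ (g (suc s)) (n C s) _)

-- ∑-sizes u f sums f a b over the ordered splittings of a u-element set into parts of sizes a, b.
∑-sizes : ℕ → (ℕ → ℕ → ℕ) → ℕ
∑-sizes zero    f = f 0 0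
∑-sizes (suc u) f = ∑-sizes u (λ a b → f a (suc b)) + ∑-sizes u (λ a b → f (suc a) b)

∑-sizes≡binomial : ∀ u (f : ℕ → ℕ → ℕ) → ∑-sizes u f ≡ sumBelow (suc u) (λ s → (u C s) * f (u ∸ s) s)
∑-sizes≡binomial zero    f = sym (+-identityʳ (f 0 0))
∑-sizes≡binomial (suc u) f = begin
  ∑-sizes u (λ a b → f a (suc b)) + ∑-sizes u (λ a b → f (suc a) b)
    ≡⟨ cong₂ _+_ (∑-sizes≡binomial u _) (∑-sizes≡binomial u _) ⟩
  sumBelow (suc u) (λ s → (u C s) * g (suc s)) + sumBelow (suc u) (λ s → (u C s) * f (suc (u ∸ s)) s)
    ≡⟨ cong (sumBelow (suc u) (λ s → (u C s) * g (suc s)) +_) (sumBelow-cong (suc u) (λ s s≤u →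
         cong (λ a → (u C s) * f a s) (sym (+-∸-assoc 1 (s≤s⁻¹ s≤u))))) ⟩
  sumBelow (suc u) (λ s → (u C s) * g (suc s)) + sumBelow (suc u) (λ s → (u C s) * g s)
    ≡⟨ +-comm (sumBelow (suc u) (λ s → (u C s) * g (suc s))) _ ⟩
  sumBelow (suc u) (λ s → (u C s) * g s) + sumBelow (suc u) (λ s → (u C s) * g (suc s))
    ≡⟨ sym (sumBelow-pascal u g) ⟩
  sumBelow (suc (suc u)) (λ s → (suc u C s) * g s) ∎
  where
    g : ℕ → ℕ
    g s = f (suc u ∸ s) s

-- Splittings of a subset

isEmpty : ∀ {n} → Subset n → Bool
isEmpty U = ∣ U ∣ ≡ᵇ 0

_⊆ᵇ_ : ∀ {n} → Subset n → Subset n → Bool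
[]          ⊆ᵇ []      = true
(false ∷ S) ⊆ᵇ (_ ∷ U) = S ⊆ᵇ U
(true ∷ S)  ⊆ᵇ (u ∷ U) = u ∧ (S ⊆ᵇ U)

-- ∑-split U F sums F S R over the ordered pairs of disjoint subsets with S ∪ R = U.
∑-split : ∀ {n} → Subset n → (Subset n → Subset n → ℕ) → ℕ
∑-split []          F = F [] []
∑-split (false ∷ U) F = ∑-split U (λ S R → F (false ∷ S) (false ∷ R))
∑-split (true ∷ U)  F = ∑-split U (λ S R → F (false ∷ S) (true ∷ R))
                      + ∑-split U (λ S R → F (true ∷ S) (false ∷ R))

∑-split-cong : ∀ {n} (U : Subset n) {F G : Subset n → Subset n → ℕ} →
  (∀ S R → ∣ S ∣ + ∣ R ∣ ≡ ∣ U ∣ → F S R ≡ G S R) → ∑-split U F ≡ ∑-split U G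
∑-split-cong []          F≡G = F≡G [] [] refl
∑-split-cong (false ∷ U) F≡G = ∑-split-cong U (λ S R → F≡G (false ∷ S) (false ∷ R))
∑-split-cong (true ∷ U)  F≡G = cong₂ _+_
  (∑-split-cong U (λ S R e → F≡G (false ∷ S) (true ∷ R) (trans (+-suc ∣ S ∣ ∣ R ∣) (cong suc e))))
  (∑-split-cong U (λ S R e → F≡G (true ∷ S) (false ∷ R) (cong suc e)))

∑-split-+ : ∀ {n} (U : Subset n) (F G : Subset n → Subset n → ℕ) →
  ∑-split U (λ S R → F S R + G S R) ≡ ∑-split U F + ∑-split U G
∑-split-+ []          F G = refl
∑-split-+ (false ∷ U) F G = ∑-split-+ U _ _
∑-split-+ (true ∷ U)  F G = trans (cong₂ _+_ (∑-split-+ U F₀ G₀) (∑-split-+ U F₁ G₁))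
  (interchange (∑-split U F₀) (∑-split U G₀) (∑-split U F₁) (∑-split U G₁))
  where
    F₀ G₀ F₁ G₁ : Subset _ → Subset _ → ℕ
    F₀ S R = F (false ∷ S) (true ∷ R)
    G₀ S R = G (false ∷ S) (true ∷ R)
    F₁ S R = F (true ∷ S) (false ∷ R)
    G₁ S R = G (true ∷ S) (false ∷ R)

∑-split-* : ∀ {n} (U : Subset n) a (F : Subset n → Subset n → ℕ) →
  ∑-split U (λ S R → a * F S R) ≡ a * ∑-split U F
∑-split-* []          a F = refl
∑-split-* (false ∷ U) a F = ∑-split-* U a _
∑-split-* (true ∷ U)  a F =
  trans (cong₂ _+_ (∑-split-* U a _) (∑-split-* U a _)) (sym (*-distribˡ-+ a _ _))

∑-split-*ʳ : ∀ {n} (U : Subset n) a (F : Subset n → Subset n → ℕ) →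
  ∑-split U (λ S R → F S R * a) ≡ ∑-split U F * a
∑-split-*ʳ U a F =
  trans (∑-split-cong U (λ S R _ → *-comm (F S R) a)) (trans (∑-split-* U a F) (*-comm a _))

∑-split-zero : ∀ {n} (U : Subset n) → ∑-split U (λ _ _ → 0) ≡ 0
∑-split-zero U = ∑-split-* U 0 (λ _ _ → 0)

∑-split-∅ˡ : ∀ {n} (U : Subset n) (f : Subset n → ℕ) → ∑-split U (λ S R → 𝟙 (isEmpty S) * f R) ≡ f U
∑-split-∅ˡ []          f = +-identityʳ (f [])
∑-split-∅ˡ (false ∷ U) f = ∑-split-∅ˡ U (λ R → f (false ∷ R))
∑-split-∅ˡ (true ∷ U)  f =
  trans (cong₂ _+_ (∑-split-∅ˡ U (λ R → f (true ∷ R))) (∑-split-zero U)) (+-identityʳ _)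

∑-split-assoc : ∀ {n} (U : Subset n) (F : Subset n → Subset n → Subset n → ℕ) →
  ∑-split U (λ T R → ∑-split T (λ S T′ → F S T′ R)) ≡
  ∑-split U (λ S R′ → ∑-split R′ (λ T′ R → F S T′ R))
∑-split-assoc []          F = refl
∑-split-assoc (false ∷ U) F = ∑-split-assoc U _
∑-split-assoc (true ∷ U)  F = begin
  a′ + ∑-split U (λ T R → ∑-split T (F₂ R) + ∑-split T (F₃ R))
    ≡⟨ cong (a′ +_) (∑-split-+ U _ _) ⟩
  a′ + (b′ + c′)
    ≡⟨ cong₂ _+_ (∑-split-assoc U _) (cong₂ _+_ (∑-split-assoc U _) (∑-split-assoc U _)) ⟩
  a + (b + c)
    ≡⟨ sym (+-assoc a b c) ⟩
  a + b + c
    ≡⟨ cong (_+ c) (sym (∑-split-+ U _ _)) ⟩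
  ∑-split U (λ S R′ → ∑-split R′ (λ T′ R → F₁ R S T′) + ∑-split R′ (λ T′ R → F₂ R S T′)) + c ∎
  where
    F₁ F₂ F₃ : Subset _ → Subset _ → Subset _ → ℕ
    F₁ R S T′ = F (false ∷ S) (false ∷ T′) (true ∷ R)
    F₂ R S T′ = F (false ∷ S) (true ∷ T′) (false ∷ R)
    F₃ R S T′ = F (true ∷ S) (false ∷ T′) (false ∷ R)
    a′ = ∑-split U (λ T R → ∑-split T (F₁ R))
    b′ = ∑-split U (λ T R → ∑-split T (F₂ R))
    c′ = ∑-split U (λ T R → ∑-split T (F₃ R))
    a  = ∑-split U (λ S R′ → ∑-split R′ (λ T′ R → F₁ R S T′))
    b  = ∑-split U (λ S R′ → ∑-split R′ (λ T′ R → F₂ R S T′))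
    c  = ∑-split U (λ S R′ → ∑-split R′ (λ T′ R → F₃ R S T′))

∑-split-sizes : ∀ {n} (U : Subset n) (f : ℕ → ℕ → ℕ) → ∑-split U (λ S R → f ∣ S ∣ ∣ R ∣) ≡ ∑-sizes ∣ U ∣ f
∑-split-sizes []          f = refl
∑-split-sizes (false ∷ U) f = ∑-split-sizes U f
∑-split-sizes (true ∷ U)  f = cong₂ _+_ (∑-split-sizes U _) (∑-split-sizes U _)

∑-subsets≡∑-split : ∀ n (U : Subset n) (F : Subset n → Subset n → ℕ) →
  ∑ (allSubsets n) (λ S → 𝟙 (S ⊆ᵇ U) * F S (U ─ S)) ≡ ∑-split U F
∑-subsets≡∑-split zero [] F = trans (+-identityʳ (F [] [] + 0)) (+-identityʳ (F [] []))
∑-subsets≡∑-split (suc n) (u ∷ U) F = begin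
  ∑ (concatMap (λ S → (false ∷ S) ∷ (true ∷ S) ∷ []) (allSubsets n)) h
    ≡⟨ ∑-concatMap _ (allSubsets n) h ⟩
  ∑ (allSubsets n) (λ S → h (false ∷ S) + (h (true ∷ S) + 0))
    ≡⟨ ∑-cong (allSubsets n) (λ S → cong (h (false ∷ S) +_) (+-identityʳ _)) ⟩
  ∑ (allSubsets n) (λ S → h (false ∷ S) + h (true ∷ S))
    ≡⟨ ∑-+ (allSubsets n) _ _ ⟩
  ∑ (allSubsets n) (λ S → h (false ∷ S)) + ∑ (allSubsets n) (λ S → h (true ∷ S))
    ≡⟨ split u ⟩
  ∑-split (u ∷ U) F ∎
  where
    h : Subset (suc n) → ℕ
    h S = 𝟙 (S ⊆ᵇ (u ∷ U)) * F S ((u ∷ U) ─ S)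
    split : ∀ u → ∑ (allSubsets n) (λ S → 𝟙 (S ⊆ᵇ U) * F (false ∷ S) (u ∷ (U ─ S)))
                  + ∑ (allSubsets n) (λ S → 𝟙 (u ∧ (S ⊆ᵇ U)) * F (true ∷ S) (false ∷ (U ─ S)))
                ≡ ∑-split (u ∷ U) F
    split false = trans (cong₂ _+_ (∑-subsets≡∑-split n U _) (∑-zero (allSubsets n))) (+-identityʳ _)
    split true  = cong₂ _+_ (∑-subsets≡∑-split n U _) (∑-subsets≡∑-split n U _)

size-induction : (P : ∀ {n} → Subset n → Set) →
  (∀ {n} (U : Subset n) → (∀ {n′} (R : Subset n′) → ∣ R ∣ < ∣ U ∣ → P R) → P U) →
  ∀ {n} (U : Subset n) → P U
size-induction P step U = go (suc ∣ U ∣) U ≤-refl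
  where
    go : ∀ b {n} (U : Subset n) → ∣ U ∣ < b → P U
    go (suc b) U U<b = step U (λ R R<U → go b R (<-≤-trans R<U (s≤s⁻¹ U<b)))

-- For S = ∅ the weight vanishes; otherwise R is a proper part of U.
nonempty-*-cong : ∀ {n} (S R U : Subset n) {x y} → ∣ S ∣ + ∣ R ∣ ≡ ∣ U ∣ → (∣ R ∣ < ∣ U ∣ → x ≡ y) →
  𝟙 (not (isEmpty S)) * x ≡ 𝟙 (not (isEmpty S)) * y
nonempty-*-cong S R U = go ∣ S ∣
  where
    go : ∀ a {x y} → a + ∣ R ∣ ≡ ∣ U ∣ → (∣ R ∣ < ∣ U ∣ → x ≡ y) → 𝟙 (not (a ≡ᵇ 0)) * x ≡ 𝟙 (not (a ≡ᵇ 0)) * y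
    go zero    _    _   = refl
    go (suc a) e    x≡y = cong (1 *_) (x≡y (subst (∣ R ∣ <_) e (s≤s (m≤n+m ∣ R ∣ a))))

-- Arrangements of a subset

-- In the recursion, U is the set of elements not yet placed.
arranges : ∀ {n} → ℕ → Subset n → List (Token n) → Bool
arranges m       U []            = (m ≡ᵇ 0) ∧ isEmpty U
arranges m       U (just S ∷ w)  = S ⊆ᵇ U ∧ (not (isEmpty S) ∧ arranges m (U ─ S) w)
arranges zero    U (nothing ∷ w) = false
arranges (suc m) U (nothing ∷ w) = arranges m U w

CoversExactly : ∀ {n} → Subset n → List (Token n) → Set
CoversExactly {n} U w = (i : Fin n) → occurrences i w ≡ 𝟙 (lookup U i)

Arrangement : ∀ {n} → ℕ → Subset n → List (Token n) → Set
Arrangement m U w = (bars w ≡ m) × BlocksNonEmpty w × CoversExactly U w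

T-isEmpty⇔ : ∀ {n} (U : Subset n) → T (isEmpty U) ⇔ CoversExactly U []
T-isEmpty⇔ U = mk⇔ (empty⇒ U) (⇒empty U)
  where
    empty⇒ : ∀ {n} (U : Subset n) → T (isEmpty U) → CoversExactly U []
    empty⇒ (false ∷ U) t zero    = refl
    empty⇒ (false ∷ U) t (suc i) = empty⇒ U t i
    ⇒empty : ∀ {n} (U : Subset n) → CoversExactly U [] → T (isEmpty U)
    ⇒empty []          _ = _
    ⇒empty (false ∷ U) c = ⇒empty U (λ i → c (suc i))
    ⇒empty (true ∷ U)  c with c zero
    ... | ()

NonEmptySubset⇔ : ∀ {n} (S : Subset n) → NonEmptySubset S ⇔ T (not (isEmpty S))
NonEmptySubset⇔ S = mk⇔ nonEmpty⇒ (⇒nonEmpty S)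
  where
    nonEmpty⇒ : ∀ {n} {S : Subset n} → NonEmptySubset S → T (not (isEmpty S))
    nonEmpty⇒ here                 = _
    nonEmpty⇒ (there {b = true} p)  = _
    nonEmpty⇒ (there {b = false} p) = nonEmpty⇒ p
    ⇒nonEmpty : ∀ {n} (S : Subset n) → T (not (isEmpty S)) → NonEmptySubset S
    ⇒nonEmpty (true ∷ S)  _ = here
    ⇒nonEmpty (false ∷ S) t = there (⇒nonEmpty S t)

T-⊆ᵇ⇔ : ∀ {n} (S U : Subset n) → T (S ⊆ᵇ U) ⇔ (∀ i → T (lookup S i) → T (lookup U i))
T-⊆ᵇ⇔ S U = mk⇔ (⊆ᵇ⇒ S U) (⇒⊆ᵇ S U)
  where
    ⊆ᵇ⇒ : ∀ {n} (S U : Subset n) → T (S ⊆ᵇ U) → ∀ i → T (lookup S i) → T (lookup U i)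
    ⊆ᵇ⇒ (true ∷ S)  (u ∷ U) t zero    _ = proj₁ (to (T-∧ {u}) t)
    ⊆ᵇ⇒ (false ∷ S) (u ∷ U) t (suc i)   = ⊆ᵇ⇒ S U t i
    ⊆ᵇ⇒ (true ∷ S)  (u ∷ U) t (suc i)   = ⊆ᵇ⇒ S U (proj₂ (to (T-∧ {u}) t)) i
    ⇒⊆ᵇ : ∀ {n} (S U : Subset n) → (∀ i → T (lookup S i) → T (lookup U i)) → T (S ⊆ᵇ U)
    ⇒⊆ᵇ []          []      _ = _
    ⇒⊆ᵇ (false ∷ S) (u ∷ U) h = ⇒⊆ᵇ S U (λ i → h (suc i))
    ⇒⊆ᵇ (true ∷ S)  (u ∷ U) h = from (T-∧ {u}) (h zero _ , ⇒⊆ᵇ S U (λ i → h (suc i)))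

lookup-─ : ∀ {n} (U S : Subset n) i → lookup (U ─ S) i ≡ (if lookup S i then false else lookup U i)
lookup-─ (u ∷ U) (false ∷ S) zero    = refl
lookup-─ (u ∷ U) (true ∷ S)  zero    = refl
lookup-─ (_ ∷ U) (_ ∷ S)     (suc i) = lookup-─ U S i

-- A block S uses element i exactly when i is still unplaced, and then removes it.
block-occurrence⇔ : ∀ s u o → (𝟙 s + o ≡ 𝟙 u) ⇔ ((T s → T u) × o ≡ 𝟙 (if s then false else u))
block-occurrence⇔ false u     o = mk⇔ (λ e → (λ ()) , e) proj₂
block-occurrence⇔ true  true  o = mk⇔ (λ e → (λ _ → _) , suc-injective e) (λ (_ , e) → cong suc e)
block-occurrence⇔ true  false o = mk⇔ (λ ()) (λ (s⇒u , _) → ⊥-elim (s⇒u _))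

covers-block⇔ : ∀ {n} (S U : Subset n) w →
  CoversExactly U (just S ∷ w) ⇔ (T (S ⊆ᵇ U) × CoversExactly (U ─ S) w)
covers-block⇔ S U w = mk⇔
  (λ c → from (T-⊆ᵇ⇔ S U) (λ i → proj₁ (to (step i) (c i)))
       , (λ i → trans (proj₂ (to (step i) (c i))) (sym (cong 𝟙 (lookup-─ U S i)))))
  (λ (S⊆U , c) i → from (step i) (to (T-⊆ᵇ⇔ S U) S⊆U i , trans (c i) (cong 𝟙 (lookup-─ U S i))))
  where step = λ i → block-occurrence⇔ (lookup S i) (lookup U i) (occurrences i w)

arranges-sound : ∀ {n} m (U : Subset n) w → T (arranges m U w) → Arrangement m U w
arranges-sound m U [] t with to (T-∧ {m ≡ᵇ 0}) t
... | m≡0 , empty = sym (≡ᵇ⇒≡ m 0 m≡0) , [] , to (T-isEmpty⇔ U) empty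
arranges-sound (suc m) U (nothing ∷ w) t with arranges-sound m U w t
... | refl , blocks , c = refl , bar∷ blocks , c
arranges-sound m U (just S ∷ w) t with to (T-∧ {S ⊆ᵇ U}) t
... | S⊆U , t′ with to (T-∧ {not (isEmpty S)}) t′
... | nonempty , t″ with arranges-sound m (U ─ S) w t″
... | bars≡ , blocks , c =
  bars≡ , blk∷ (from (NonEmptySubset⇔ S) nonempty) blocks , from (covers-block⇔ S U w) (S⊆U , c)

arranges-complete : ∀ {n} m (U : Subset n) w → Arrangement m U w → T (arranges m U w)
arranges-complete m U [] (refl , _ , c) = from (T-isEmpty⇔ U) c
arranges-complete zero U (nothing ∷ w) (() , _)
arranges-complete (suc m) U (nothing ∷ w) (refl , bar∷ blocks , c) =
  arranges-complete m U w (refl , blocks , c)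
arranges-complete m U (just S ∷ w) (bars≡ , blk∷ nonempty blocks , c) with to (covers-block⇔ S U w) c
... | S⊆U , c′ = from (T-∧ {S ⊆ᵇ U}) (S⊆U , from (T-∧ {not (isEmpty S)})
  (to (NonEmptySubset⇔ S) nonempty , arranges-complete m (U ─ S) w (bars≡ , blocks , c′)))

IsBPA⇔arranges : ∀ n m w → IsBPA n m w ⇔ T (arranges m ⊤ w)
IsBPA⇔arranges n m w = mk⇔
  (λ (b , blocks , c) → arranges-complete m ⊤ w (b , blocks , λ i → trans (c i) (sym (one i))))
  (λ t → let (b , blocks , c) = arranges-sound m ⊤ w t in b , blocks , λ i → trans (c i) (one i))
  where
    one : (i : Fin n) → 𝟙 (lookup (⊤ {n}) i) ≡ 1
    one i = cong 𝟙 (lookup-replicate i true)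

arrangementsOfLength : ∀ {n} → ℕ → ℕ → Subset n → ℕ
arrangementsOfLength {n} L m U = ∑ (wordsOfLength n L) (λ w → 𝟙 (arranges m U w))

-- The length bound n + m is the one used in J; arrangementsOfLength-vanishes shows it loses nothing.
arrangements : ∀ {n} → ℕ → Subset n → ℕ
arrangements {n} m U = sumBelow (suc (n + m)) (λ L → arrangementsOfLength L m U)

∑-wordsUpTo : ∀ n N (g : List (Token n) → ℕ) →
  ∑ (wordsUpTo n N) g ≡ sumBelow (suc N) (λ L → ∑ (wordsOfLength n L) g)
∑-wordsUpTo n zero    g = refl
∑-wordsUpTo n (suc N) g = begin
  ∑ (wordsOfLength n (suc N) ++ wordsUpTo n N) g
    ≡⟨ ∑-++ (wordsOfLength n (suc N)) _ g ⟩
  ∑ (wordsOfLength n (suc N)) g + ∑ (wordsUpTo n N) g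
    ≡⟨ cong₂ _+_ refl (∑-wordsUpTo n N g) ⟩
  ∑ (wordsOfLength n (suc N)) g + sumBelow (suc N) (λ L → ∑ (wordsOfLength n L) g)
    ≡⟨ +-comm (∑ (wordsOfLength n (suc N)) g) _ ⟩
  sumBelow (suc (suc N)) (λ L → ∑ (wordsOfLength n L) g) ∎

J≡arrangements : ∀ m n → J m n ≡ arrangements m (⊤ {n})
J≡arrangements m n = begin
  length (filter (isBPA? n m) W)
    ≡⟨ length-filter≡∑ (isBPA? n m) W ⟩
  ∑ W (λ w → 𝟙 (does (isBPA? n m w)))
    ≡⟨ ∑-cong W (λ w → cong 𝟙 (does-≡ (isBPA? n m w) (IsBPA⇔arranges n m w))) ⟩
  ∑ W (λ w → 𝟙 (arranges m ⊤ w))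
    ≡⟨ ∑-wordsUpTo n (n + m) _ ⟩
  arrangements m (⊤ {n}) ∎
  where W = wordsUpTo n (n + m)

-- The recursion on the first token

-- The contribution of the words with m bars whose first token is a bar.
atPred : (ℕ → ℕ) → ℕ → ℕ
atPred f zero    = 0
atPred f (suc m) = f m

arrangementsOfLength-suc : ∀ {n} L m (U : Subset n) →
  arrangementsOfLength (suc L) m U ≡
  atPred (λ m′ → arrangementsOfLength L m′ U) m
    + ∑-split U (λ S R → 𝟙 (not (isEmpty S)) * arrangementsOfLength L m R)
arrangementsOfLength-suc {n} L m U = begin
  ∑ (concatMap (λ w → map (_∷ w) (nothing ∷ map just Sets)) W) f
    ≡⟨ ∑-concatMap _ W f ⟩
  ∑ W (λ w → f (nothing ∷ w) + ∑ (map (_∷ w) (map just Sets)) f)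
    ≡⟨ ∑-cong W (λ w → cong (f (nothing ∷ w) +_)
         (trans (∑-map (_∷ w) (map just Sets) f) (∑-map just Sets (λ t → f (t ∷ w))))) ⟩
  ∑ W (λ w → f (nothing ∷ w) + ∑ Sets (λ S → f (just S ∷ w)))
    ≡⟨ ∑-+ W _ _ ⟩
  ∑ W (λ w → f (nothing ∷ w)) + ∑ W (λ w → ∑ Sets (λ S → f (just S ∷ w)))
    ≡⟨ cong₂ _+_ (starting-with-bar m) (∑-comm W Sets (λ w S → f (just S ∷ w))) ⟩
  atPred (λ m′ → arrangementsOfLength L m′ U) m + ∑ Sets (λ S → ∑ W (λ w → f (just S ∷ w)))
    ≡⟨ cong₂ _+_ refl (trans (∑-cong Sets starting-with-block) (∑-subsets≡∑-split n U _)) ⟩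
  atPred (λ m′ → arrangementsOfLength L m′ U) m
    + ∑-split U (λ S R → 𝟙 (not (isEmpty S)) * arrangementsOfLength L m R) ∎
  where
    W = wordsOfLength n L
    Sets = allSubsets n
    f : List (Token n) → ℕ
    f w = 𝟙 (arranges m U w)
    starting-with-bar : ∀ m → ∑ W (λ w → 𝟙 (arranges m U (nothing ∷ w)))
                              ≡ atPred (λ m′ → arrangementsOfLength L m′ U) m
    starting-with-bar zero    = ∑-zero W
    starting-with-bar (suc m) = refl
    starting-with-block : ∀ S → ∑ W (λ w → f (just S ∷ w))
      ≡ 𝟙 (S ⊆ᵇ U) * (𝟙 (not (isEmpty S)) * arrangementsOfLength L m (U ─ S))
    starting-with-block S = begin
      ∑ W (λ w → f (just S ∷ w))
        ≡⟨ ∑-cong W (λ w → trans (𝟙-∧ (S ⊆ᵇ U) _) (cong (𝟙 (S ⊆ᵇ U) *_) (𝟙-∧ (not (isEmpty S)) _))) ⟩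
      ∑ W (λ w → 𝟙 (S ⊆ᵇ U) * (𝟙 (not (isEmpty S)) * 𝟙 (arranges m (U ─ S) w)))
        ≡⟨ ∑-* W (𝟙 (S ⊆ᵇ U)) (λ w → 𝟙 (not (isEmpty S)) * 𝟙 (arranges m (U ─ S) w)) ⟩
      𝟙 (S ⊆ᵇ U) * ∑ W (λ w → 𝟙 (not (isEmpty S)) * 𝟙 (arranges m (U ─ S) w))
        ≡⟨ cong (𝟙 (S ⊆ᵇ U) *_) (∑-* W (𝟙 (not (isEmpty S))) (λ w → 𝟙 (arranges m (U ─ S) w))) ⟩
      𝟙 (S ⊆ᵇ U) * (𝟙 (not (isEmpty S)) * arrangementsOfLength L m (U ─ S)) ∎

-- Each token is a bar or places at least one element.
arrangementsOfLength-vanishes : ∀ {n} L m (U : Subset n) → m + ∣ U ∣ < L → arrangementsOfLength L m U ≡ 0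
arrangementsOfLength-vanishes (suc L) m U m+U<L = begin
  arrangementsOfLength (suc L) m U
    ≡⟨ arrangementsOfLength-suc L m U ⟩
  atPred (λ m′ → arrangementsOfLength L m′ U) m + ∑-split U (λ S R → w S * arrangementsOfLength L m R)
    ≡⟨ cong₂ _+_ (starting-with-bar m m+U<L) (∑-split-cong U starting-with-block) ⟩
  0 + ∑-split U (λ _ _ → 0)
    ≡⟨ ∑-split-zero U ⟩
  0 ∎
  where
    w : Subset _ → ℕ
    w S = 𝟙 (not (isEmpty S))
    starting-with-bar : ∀ m → m + ∣ U ∣ < suc L → atPred (λ m′ → arrangementsOfLength L m′ U) m ≡ 0
    starting-with-bar zero    _ = refl
    starting-with-bar (suc m) m+U<L = arrangementsOfLength-vanishes L m U (s≤s⁻¹ m+U<L)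
    starting-with-block : ∀ S R → ∣ S ∣ + ∣ R ∣ ≡ ∣ U ∣ → w S * arrangementsOfLength L m R ≡ 0
    starting-with-block S R e = trans
      (nonempty-*-cong S R U e (λ R<U →
        arrangementsOfLength-vanishes L m R (<-≤-trans (+-monoʳ-< m R<U) (s≤s⁻¹ m+U<L))))
      (*-zeroʳ (w S))

arrangements-bound : ∀ {n} m (U : Subset n) {B} → m + ∣ U ∣ ≤ B →
  arrangements m U ≡ sumBelow (suc B) (λ L → arrangementsOfLength L m U)
arrangements-bound {n} m U m+U≤B =
  trans (sumBelow-vanishing _ vanish (s≤s m+U≤n+m)) (sym (sumBelow-vanishing _ vanish (s≤s m+U≤B)))
  where
    vanish : ∀ L → suc (m + ∣ U ∣) ≤ L → arrangementsOfLength L m U ≡ 0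
    vanish L = arrangementsOfLength-vanishes L m U
    m+U≤n+m : m + ∣ U ∣ ≤ n + m
    m+U≤n+m = ≤-trans (+-monoʳ-≤ m (∣p∣≤n U)) (≤-reflexive (+-comm m n))

arrangements-rec : ∀ {n} m (U : Subset n) →
  arrangements m U ≡
  𝟙 (arranges m U []) + atPred (λ m′ → arrangements m′ U) m
    + ∑-split U (λ S R → 𝟙 (not (isEmpty S)) * arrangements m R)
arrangements-rec m U = begin
  arrangements m U
    ≡⟨ arrangements-bound m U (n≤1+n K) ⟩
  sumBelow (suc (suc K)) c
    ≡⟨ sumBelow-suc (suc K) c ⟩
  c 0 + sumBelow (suc K) (λ L → c (suc L))
    ≡⟨ cong₂ _+_ (+-identityʳ (𝟙 (arranges m U [])))
         (sumBelow-cong (suc K) (λ L _ → arrangementsOfLength-suc L m U)) ⟩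
  𝟙 (arranges m U []) + sumBelow (suc K) (λ L → atPred (λ m′ → arrangementsOfLength L m′ U) m
                                              + ∑-split U (λ S R → w S * arrangementsOfLength L m R))
    ≡⟨ cong (𝟙 (arranges m U []) +_)
         (trans (sumBelow-+ (suc K) _ _) (cong₂ _+_ (starting-with-bar m) starting-with-block)) ⟩
  𝟙 (arranges m U []) + (atPred (λ m′ → arrangements m′ U) m + ∑-split U (λ S R → w S * arrangements m R))
    ≡⟨ sym (+-assoc (𝟙 (arranges m U [])) _ _) ⟩
  𝟙 (arranges m U []) + atPred (λ m′ → arrangements m′ U) m + ∑-split U (λ S R → w S * arrangements m R) ∎
  where
    K = m + ∣ U ∣
    c : ℕ → ℕ
    c L = arrangementsOfLength L m U
    w : Subset _ → ℕ
    w S = 𝟙 (not (isEmpty S))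
    starting-with-bar : ∀ m → sumBelow (suc (m + ∣ U ∣)) (λ L → atPred (λ m′ → arrangementsOfLength L m′ U) m)
                              ≡ atPred (λ m′ → arrangements m′ U) m
    starting-with-bar zero    = sumBelow-zero (suc ∣ U ∣)
    starting-with-bar (suc m) = sym (arrangements-bound m U (n≤1+n _))
    starting-with-block : sumBelow (suc K) (λ L → ∑-split U (λ S R → w S * arrangementsOfLength L m R))
                          ≡ ∑-split U (λ S R → w S * arrangements m R)
    starting-with-block = trans (sumBelow-∑-split (suc K))
      (∑-split-cong U (λ S R e → trans (sumBelow-* (suc K) (w S) _) (nonempty-*-cong S R U e (λ R<U →
        sym (arrangements-bound m R (+-monoʳ-≤ m (<⇒≤ R<U)))))))
      where
        sumBelow-∑-split : ∀ N → sumBelow N (λ L → ∑-split U (λ S R → w S * arrangementsOfLength L m R))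
                                 ≡ ∑-split U (λ S R → sumBelow N (λ L → w S * arrangementsOfLength L m R))
        sumBelow-∑-split zero    = sym (∑-split-zero U)
        sumBelow-∑-split (suc N) = trans (cong₂ _+_ (sumBelow-∑-split N) refl) (sym (∑-split-+ U _ _))

-- The count depends on the size only

J-unfolded : ℕ → ℕ → ℕ
J-unfolded m u = 𝟙 ((m ≡ᵇ 0) ∧ (u ≡ᵇ 0)) + atPred (λ m′ → J m′ u) m
                 + ∑-sizes u (λ a r → 𝟙 (not (a ≡ᵇ 0)) * J m r)

arrangements-unfold : ∀ m {n} (U : Subset n) →
  atPred (λ m′ → arrangements m′ U) m ≡ atPred (λ m′ → J m′ ∣ U ∣) m →
  (∀ {n′} (R : Subset n′) → ∣ R ∣ < ∣ U ∣ → arrangements m R ≡ J m ∣ R ∣) →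
  arrangements m U ≡ J-unfolded m ∣ U ∣
arrangements-unfold m U bars≡ smaller≡ = begin
  arrangements m U
    ≡⟨ arrangements-rec m U ⟩
  𝟙 (arranges m U []) + atPred (λ m′ → arrangements m′ U) m + ∑-split U (λ S R → w S * arrangements m R)
    ≡⟨ cong₂ (λ b s → 𝟙 (arranges m U []) + b + s) bars≡
         (∑-split-cong U (λ S R e → nonempty-*-cong S R U e (smaller≡ R))) ⟩
  𝟙 (arranges m U []) + atPred (λ m′ → J m′ ∣ U ∣) m + ∑-split U (λ S R → w S * J m ∣ R ∣)
    ≡⟨ cong₂ _+_ refl (∑-split-sizes U _) ⟩
  J-unfolded m ∣ U ∣ ∎
  where
    w : Subset _ → ℕ
    w S = 𝟙 (not (isEmpty S))

mutual
  arrangements≡J : ∀ m {n} (U : Subset n) → arrangements m U ≡ J m ∣ U ∣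
  arrangements≡J m = size-induction (λ U → arrangements m U ≡ J m ∣ U ∣) step
    where
      step : ∀ {n} (U : Subset n) → (∀ {n′} (R : Subset n′) → ∣ R ∣ < ∣ U ∣ → arrangements m R ≡ J m ∣ R ∣) →
             arrangements m U ≡ J m ∣ U ∣
      step U smaller≡ = begin
        arrangements m U
          ≡⟨ arrangements-unfold m U (atPred-arrangements≡J m U) smaller≡ ⟩
        J-unfolded m ∣ U ∣
          ≡⟨ cong (J-unfolded m) (sym (∣⊤∣≡n ∣ U ∣)) ⟩
        J-unfolded m ∣ ⊤ {∣ U ∣} ∣
          ≡⟨ sym (arrangements-unfold m (⊤ {∣ U ∣}) (atPred-arrangements≡J m (⊤ {∣ U ∣}))
                    (λ R R<⊤ → smaller≡ R (subst (∣ R ∣ <_) (∣⊤∣≡n ∣ U ∣) R<⊤))) ⟩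
        arrangements m (⊤ {∣ U ∣})
          ≡⟨ sym (J≡arrangements m ∣ U ∣) ⟩
        J m ∣ U ∣ ∎

  atPred-arrangements≡J : ∀ m {n} (U : Subset n) →
    atPred (λ m′ → arrangements m′ U) m ≡ atPred (λ m′ → J m′ ∣ U ∣) m
  atPred-arrangements≡J zero    U = refl
  atPred-arrangements≡J (suc m) U = arrangements≡J m U

-- The section before the first bar

arrangements-suc : ∀ k {n} (U : Subset n) →
  arrangements (suc k) U ≡ ∑-split U (λ T R → arrangements 0 T * arrangements k R)
arrangements-suc k = size-induction (λ U → arrangements (suc k) U ≡ ∑-split U (λ T R → A₀ T * Aₖ R)) step
  where
    A₀ Aₖ : ∀ {n′} → Subset n′ → ℕ
    A₀ = arrangements 0
    Aₖ = arrangements k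
    w : ∀ {n′} → Subset n′ → ℕ
    w S = 𝟙 (not (isEmpty S))
    distribute : ∀ {n} (T R : Subset n) →
      (𝟙 (isEmpty T) + 0 + ∑-split T (λ S T′ → w S * A₀ T′)) * Aₖ R
      ≡ 𝟙 (isEmpty T) * Aₖ R + ∑-split T (λ S T′ → w S * A₀ T′ * Aₖ R)
    distribute T R = trans (*-distribʳ-+ (Aₖ R) (𝟙 (isEmpty T) + 0) _)
      (cong₂ _+_ (cong (_* Aₖ R) (+-identityʳ (𝟙 (isEmpty T)))) (sym (∑-split-*ʳ T (Aₖ R) _)))
    step : ∀ {n′} (U : Subset n′) →
      (∀ {n″} (R : Subset n″) → ∣ R ∣ < ∣ U ∣ → arrangements (suc k) R ≡ ∑-split R (λ T R′ → A₀ T * Aₖ R′)) →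
      arrangements (suc k) U ≡ ∑-split U (λ T R → A₀ T * Aₖ R)
    step U smaller≡ = sym (begin
      ∑-split U (λ T R → A₀ T * Aₖ R)
        ≡⟨ ∑-split-cong U (λ T R _ → trans (cong (_* Aₖ R) (arrangements-rec 0 T)) (distribute T R)) ⟩
      ∑-split U (λ T R → 𝟙 (isEmpty T) * Aₖ R + ∑-split T (λ S T′ → w S * A₀ T′ * Aₖ R))
        ≡⟨ ∑-split-+ U _ _ ⟩
      ∑-split U (λ T R → 𝟙 (isEmpty T) * Aₖ R) + ∑-split U (λ T R → ∑-split T (λ S T′ → w S * A₀ T′ * Aₖ R))
        ≡⟨ cong₂ _+_ (∑-split-∅ˡ U Aₖ) (∑-split-assoc U (λ S T′ R → w S * A₀ T′ * Aₖ R)) ⟩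
      Aₖ U + ∑-split U (λ S R′ → ∑-split R′ (λ T′ R → w S * A₀ T′ * Aₖ R))
        ≡⟨ cong (Aₖ U +_) (∑-split-cong U after-first-block) ⟩
      Aₖ U + ∑-split U (λ S R → w S * arrangements (suc k) R)
        ≡⟨ sym (arrangements-rec (suc k) U) ⟩
      arrangements (suc k) U ∎)
      where
        after-first-block : ∀ S R′ → ∣ S ∣ + ∣ R′ ∣ ≡ ∣ U ∣ →
          ∑-split R′ (λ T′ R → w S * A₀ T′ * Aₖ R) ≡ w S * arrangements (suc k) R′
        after-first-block S R′ e = begin
          ∑-split R′ (λ T′ R → w S * A₀ T′ * Aₖ R)
            ≡⟨ ∑-split-cong R′ (λ T′ R _ → *-assoc (w S) _ _) ⟩
          ∑-split R′ (λ T′ R → w S * (A₀ T′ * Aₖ R))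
            ≡⟨ ∑-split-* R′ (w S) _ ⟩
          w S * ∑-split R′ (λ T′ R → A₀ T′ * Aₖ R)
            ≡⟨ nonempty-*-cong S R′ U e (λ R′<U → sym (smaller≡ R′ R′<U)) ⟩
          w S * arrangements (suc k) R′ ∎

J-suc : ∀ k n → J (suc k) n ≡ sumBelow (suc n) (λ s → (n C s) * J k s * J 0 (n ∸ s))
J-suc k n = begin
  J (suc k) n
    ≡⟨ J≡arrangements (suc k) n ⟩
  arrangements (suc k) (⊤ {n})
    ≡⟨ arrangements-suc k (⊤ {n}) ⟩
  ∑-split (⊤ {n}) (λ T R → arrangements 0 T * arrangements k R)
    ≡⟨ ∑-split-cong (⊤ {n}) (λ T R _ →
         trans (cong₂ _*_ (arrangements≡J 0 T) (arrangements≡J k R)) (*-comm (J 0 ∣ T ∣) (J k ∣ R ∣))) ⟩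
  ∑-split (⊤ {n}) (λ T R → J k ∣ R ∣ * J 0 ∣ T ∣)
    ≡⟨ ∑-split-sizes (⊤ {n}) (λ a b → J k b * J 0 a) ⟩
  ∑-sizes ∣ ⊤ {n} ∣ (λ a b → J k b * J 0 a)
    ≡⟨ cong (λ u → ∑-sizes u (λ a b → J k b * J 0 a)) (∣⊤∣≡n n) ⟩
  ∑-sizes n (λ a b → J k b * J 0 a)
    ≡⟨ ∑-sizes≡binomial n _ ⟩
  sumBelow (suc n) (λ s → (n C s) * (J k s * J 0 (n ∸ s)))
    ≡⟨ sumBelow-cong (suc n) (λ s _ → sym (*-assoc (n C s) _ _)) ⟩
  sumBelow (suc n) (λ s → (n C s) * J k s * J 0 (n ∸ s)) ∎

theorem2 : (k n : ℕ) → 1 ≤ k → 1 ≤ n →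
    J k n ≡ J (k ∸ 1) n + sumBelow n (λ s → (n C s) * J (k ∸ 1) s * J 0 (n ∸ s))
theorem2 zero    n () _
theorem2 (suc k) n _  _ = begin
  J (suc k) n
    ≡⟨ J-suc k n ⟩
  Σ + (n C n) * J k n * J 0 (n ∸ n)
    ≡⟨ cong (λ x → Σ + x) last-term ⟩
  Σ + J k n
    ≡⟨ +-comm Σ (J k n) ⟩
  J k n + Σ ∎
  where
    Σ = sumBelow n (λ s → (n C s) * J k s * J 0 (n ∸ s))
    last-term : (n C n) * J k n * J 0 (n ∸ n) ≡ J k n
    last-term = begin
      (n C n) * J k n * J 0 (n ∸ n) ≡⟨ cong₂ (λ c d → c * J k n * J 0 d) (nCn≡1 n) (n∸n≡0 n) ⟩
      1 * J k n * 1                 ≡⟨ trans (*-identityʳ (1 * J k n)) (*-identityˡ (J k n)) ⟩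
      J k n                         ∎
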